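{- Let $\Gamma=(V,E)$ and $Y$ be graphs, $N\in\mathbb{N}$, and let $(f,\{\gamma_e^i\}_{e\in E,\,i\in[N]})$ be an $N$-piecewise embedding of $\Gamma$ into $Y$. Then there exists a combinatorial embedding $\tilde f$ of $\Gamma$ into $C_{N+1}\times Y$ such that $\tilde f v=(0,fv)$ for every $v\in V$.
   Context: All graphs are finite. $C_{N+1}$ is the cycle with vertices labeled $0,1,\dots,N$ in cyclic order ($i\sim i+1 \bmod N+1$). $\times$ is the Cartesian product of graphs. $[N]=\{1,\dots,N\}$. An $N$-piecewise embedding from $\Gamma$ to $Y$ is a pair $(f,\{\gamma_e^i\})$ where $f:V(\Gamma)\to V(Y)$ is injective, each $\gamma_e^i$ is a walk in $Y$, for each edge $e$ the concatenation $\gamma_e^1\ast\cdots\ast\gamma_e^N$ is a walk whose endpoints are the images under $f$ of the endpoints of $e$, and for any two edges $e,e'$ sharing no endpoint and every $i\in[N]$, $\gamma_e^i$ and $\gamma_{e'}^i$ have disjoint vertex sets. A combinatorial embedding of $\Gamma$ into a graph $Z$ is a map $\tilde f$ assigning to each vertex $v$ a vertex $\tilde fv\in V(Z)$ and to each edge $e=uv$ a walk $\tilde f_e$ in $Z$ with endpoints $\tilde fu,\tilde fv$, such that: (1) $\tilde f|_V$ is injective; (2) for any two distinct edges $e,t$ sharing no endpoint, $\tilde f_e$ and $\tilde f_t$ have disjoint vertex sets; (3) for every edge $e$ and vertex $v\notin e$, $\tilde fv$ is not a vertex of $\tilde f_e$. -}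

module Defs where

open import Data.Nat using (ℕ; zero; suc; _<_; _%_)
open import Data.Fin using (Fin; toℕ)
open import Data.Product using (Σ; _×_; _,_; proj₁; proj₂)
open import Data.Sum using (_⊎_)
open import Data.Empty using (⊥)
open import Relation.Binary.PropositionalEquality using (_≡_)
open import Relation.Nullary using (¬_)
open import Function.Definitions using (Injective)

record Graph : Set₁ where
  field
    size  : ℕ
    Adj   : Fin size → Fin size → Set
    sym   : ∀ {u v} → Adj u v → Adj v u
    irrefl : ∀ {u} → ¬ Adj u u
open Graph public

Vtx : Graph → Set
Vtx G = Fin (size G)

-- An (undirected) edge, represented canonically by its endpoints u < v.
record Edge (G : Graph) : Set where
  constructor edge
  field
    src : Vtx G
    tgt : Vtx G
    ord : toℕ src < toℕ tgt
    adj : Adj G src tgt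
open Edge public

_∈E_ : {G : Graph} → Vtx G → Edge G → Set
v ∈E e = v ≡ src e ⊎ v ≡ tgt e

Disjoint : {G : Graph} → Edge G → Edge G → Set
Disjoint e e' = ¬ (src e ∈E e') × ¬ (tgt e ∈E e')

data Walk {V : Set} (R : V → V → Set) : V → V → Set where
  [_] : (x : V) → Walk R x x
  _∷_ : ∀ {x y z} → R x y → Walk R y z → Walk R x z

data _∈W_ {V : Set} {R : V → V → Set} (w : V) : ∀ {x y} → Walk R x y → Set where
  here-end : w ∈W [ w ]
  here     : ∀ {y z} (r : R w y) (p : Walk R y z) → w ∈W (r ∷ p)
  there    : ∀ {x y z} (r : R x y) {p : Walk R y z} → w ∈W p → w ∈W (r ∷ p)

VDisjoint : {V : Set} {R : V → V → Set} {a b c d : V} → Walk R a b → Walk R c d → Set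
VDisjoint {V} p q = (w : V) → w ∈W p → w ∈W q → ⊥

data Chain {V : Set} (R : V → V → Set) : ℕ → V → V → Set where
  []  : ∀ {x} → Chain R 0 x x
  _∷_ : ∀ {k x y z} → Walk R x y → Chain R k y z → Chain R (suc k) x z

-- the i-th piece (0-based index; piece i+1 in the paper's [N] numbering)
piece : {V : Set} {R : V → V → Set} {k : ℕ} {x y : V} →
        Chain R k x y → Fin k → Σ V λ a → Σ V λ b → Walk R a b
piece (_∷_ {x = x} {y = y} p c) Fin.zero = x , y , p
piece (p ∷ c) (Fin.suc i) = piece c i

pieceWalk : {V : Set} {R : V → V → Set} {k : ℕ} {x y : V} →
            (c : Chain R k x y) (i : Fin k) → Walk R (proj₁ (piece c i)) (proj₁ (proj₂ (piece c i)))
pieceWalk c i = proj₂ (proj₂ (piece c i))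

record PiecewiseEmbedding (N : ℕ) (Γ Y : Graph) : Set where
  field
    f     : Vtx Γ → Vtx Y
    f-inj : Injective _≡_ _≡_ f
    γ     : (e : Edge Γ) → Σ (Vtx Y) λ a → Σ (Vtx Y) λ b →
              Chain (Adj Y) N a b × ((a ≡ f (src e) × b ≡ f (tgt e)) ⊎ (a ≡ f (tgt e) × b ≡ f (src e)))
    disj  : (e e' : Edge Γ) → Disjoint e e' → (i : Fin N) →
              VDisjoint (pieceWalk (proj₁ (proj₂ (proj₂ (γ e)))) i)
                        (pieceWalk (proj₁ (proj₂ (proj₂ (γ e')))) i)

CycAdj : (N : ℕ) → Fin (suc N) → Fin (suc N) → Set
CycAdj N i j = (toℕ j ≡ suc (toℕ i) % suc N) ⊎ (toℕ i ≡ suc (toℕ j) % suc N)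

ProdAdj : (N : ℕ) (Y : Graph) → (Fin (suc N) × Vtx Y) → (Fin (suc N) × Vtx Y) → Set
ProdAdj N Y (i , y) (j , y') = (CycAdj N i j × y ≡ y') ⊎ (i ≡ j × Adj Y y y')

record CombEmbedding (Γ : Graph) (VZ : Set) (RZ : VZ → VZ → Set) : Set where
  field
    fv    : Vtx Γ → VZ
    fe    : (e : Edge Γ) → Σ VZ λ a → Σ VZ λ b → Walk RZ a b ×
              ((a ≡ fv (src e) × b ≡ fv (tgt e)) ⊎ (a ≡ fv (tgt e) × b ≡ fv (src e)))
    inj   : Injective _≡_ _≡_ fv
    disj  : (e t : Edge Γ) → ¬ (e ≡ t) → Disjoint e t →
              VDisjoint (proj₁ (proj₂ (proj₂ (fe e)))) (proj₁ (proj₂ (proj₂ (fe t))))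
    avoid : (e : Edge Γ) (v : Vtx Γ) → ¬ (v ∈E e) → ¬ (fv v ∈W proj₁ (proj₂ (proj₂ (fe e))))

{-# OPTIONS --safe #-}
-- Lift the N pieces of γ_e to the N levels 1, …, N of C_{N+1} × Y: climb one level,
-- run γ_e^1, climb, run γ_e^2, …, run γ_e^N, and close the cycle back to level 0.
-- Level 0 is then met only at the images of the endpoints of e, where injectivity of f
-- separates the walks, and level i only along γ_e^i, where the piecewise hypothesis does.
module Submission where

open import Defs hiding (sym)
open import Data.Nat using (ℕ; suc; s≤s; _%_)
open import Data.Nat.DivMod using (n%n≡0; m<n⇒m%n≡m)
open import Data.Fin using (Fin; zero; suc; inject₁; fromℕ)
open import Data.Fin.Properties using (toℕ<n; toℕ-inject₁; toℕ-fromℕ)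
open import Data.Product using (Σ; _×_; _,_; proj₁; proj₂)
open import Data.Sum using (_⊎_; inj₁; inj₂)
import Data.Sum as Sum
import Data.Product as Product
open import Function using (id; _∘_)
open import Relation.Binary.PropositionalEquality using (_≡_; refl; sym; trans; cong)
open import Relation.Nullary using (¬_)

module _ {V : Set} {R : V → V → Set} where

  _++_ : ∀ {x y z} → Walk R x y → Walk R y z → Walk R x z
  [ _ ]   ++ q = q
  (r ∷ p) ++ q = r ∷ (p ++ q)

  _▷_ : ∀ {x y z} → Walk R x y → R y z → Walk R x z
  p ▷ r = p ++ (r ∷ [ _ ])

  end-∈ : ∀ {x y} (p : Walk R x y) → y ∈W p
  end-∈ [ _ ]   = here-end
  end-∈ (r ∷ p) = there r (end-∈ p)

  ∈-++⁻ : ∀ {x y z w} (p : Walk R x y) (q : Walk R y z) → w ∈W (p ++ q) → w ∈W p ⊎ w ∈W q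
  ∈-++⁻ [ _ ]   q w∈q                     = inj₂ w∈q
  ∈-++⁻ (r ∷ p) q (here .r .(p ++ q))     = inj₁ (here r p)
  ∈-++⁻ (r ∷ p) q (there .r w∈p++q) with ∈-++⁻ p q w∈p++q
  ... | inj₁ w∈p = inj₁ (there r w∈p)
  ... | inj₂ w∈q = inj₂ w∈q

  ∈-▷⁻ : ∀ {x y z w} (p : Walk R x y) (r : R y z) → w ∈W (p ▷ r) → w ∈W p ⊎ w ≡ z
  ∈-▷⁻ p r w∈p▷r with ∈-++⁻ p _ w∈p▷r
  ... | inj₁ w∈p                 = inj₁ w∈p
  ... | inj₂ (here _ _)          = inj₁ (end-∈ p)
  ... | inj₂ (there _ here-end)  = inj₂ refl

gmap : ∀ {A B : Set} {R : A → A → Set} {S : B → B → Set} (g : A → B) →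
       (∀ {x y} → R x y → S (g x) (g y)) → ∀ {x y} → Walk R x y → Walk S (g x) (g y)
gmap g h [ x ]   = [ g x ]
gmap g h (r ∷ p) = h r ∷ gmap g h p

∈-gmap⁻ : ∀ {A B : Set} {R : A → A → Set} {S : B → B → Set} (g : A → B)
          (h : ∀ {x y} → R x y → S (g x) (g y)) {x y : A} {w : B} (p : Walk R x y) →
          w ∈W gmap {S = S} g h p → Σ A λ v → v ∈W p × w ≡ g v
∈-gmap⁻ g h [ x ]   here-end        = x , here-end , refl
∈-gmap⁻ g h (r ∷ p) (here _ _)      = _ , here r p , refl
∈-gmap⁻ g h (r ∷ p) (there _ w∈gp) with ∈-gmap⁻ g h p w∈gp
... | v , v∈p , refl = v , there r v∈p , refl

module Cartesian {L V : Set} (S : L → L → Set) (R : V → V → Set) where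

  _□_ : L × V → L × V → Set
  (i , x) □ (j , y) = (S i j × x ≡ y) ⊎ (i ≡ j × R x y)

  stay : ∀ {ℓ x y} → R x y → (ℓ , x) □ (ℓ , y)
  stay r = inj₂ (refl , r)

  atLevel : (ℓ : L) → ∀ {x y} → Walk R x y → Walk _□_ (ℓ , x) (ℓ , y)
  atLevel ℓ = gmap (ℓ ,_) stay

  ladder : ∀ {k x y} (ℓ : Fin (suc k) → L) → (∀ i → S (ℓ (inject₁ i)) (ℓ (suc i))) →
           Chain R k x y → Walk _□_ (ℓ zero , x) (ℓ (fromℕ k) , y)
  ladder ℓ step []      = [ _ ]
  ladder ℓ step (p ∷ c) =
    inj₁ (step zero , refl) ∷ (atLevel (ℓ (suc zero)) p ++ ladder (ℓ ∘ suc) (step ∘ suc) c)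

  ∈-ladder⁻ : ∀ {k x y w} (ℓ : Fin (suc k) → L) (step : ∀ i → S (ℓ (inject₁ i)) (ℓ (suc i)))
              (c : Chain R k x y) → w ∈W ladder ℓ step c →
              w ≡ (ℓ zero , x) ⊎ Σ (Fin k) λ i → Σ V λ v → v ∈W pieceWalk c i × w ≡ (ℓ (suc i) , v)
  ∈-ladder⁻ ℓ step []      here-end   = inj₁ refl
  ∈-ladder⁻ ℓ step (p ∷ c) (here _ _) = inj₁ refl
  ∈-ladder⁻ ℓ step (p ∷ c) (there _ w∈) with ∈-++⁻ (atLevel (ℓ (suc zero)) p) _ w∈
  ... | inj₁ w∈p with ∈-gmap⁻ (ℓ (suc zero) ,_) stay p w∈p
  ...   | v , v∈p , refl = inj₂ (zero , v , v∈p , refl)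
  ∈-ladder⁻ ℓ step (p ∷ c) (there _ w∈) | inj₂ w∈c with ∈-ladder⁻ (ℓ ∘ suc) (step ∘ suc) c w∈c
  ... | inj₁ refl                = inj₂ (zero , _ , end-∈ p , refl)
  ... | inj₂ (i , v , v∈c , refl) = inj₂ (suc i , v , v∈c , refl)

cycAdj-inject₁-suc : ∀ {N} (i : Fin N) → CycAdj N (inject₁ i) (suc i)
cycAdj-inject₁-suc {N} i = inj₁ (sym (trans (cong (λ n → suc n % suc N) (toℕ-inject₁ i))
                                           (m<n⇒m%n≡m (s≤s (toℕ<n i)))))

cycAdj-fromℕ-zero : ∀ N → CycAdj N (fromℕ N) zero
cycAdj-fromℕ-zero N = inj₁ (sym (trans (cong (λ n → suc n % suc N) (toℕ-fromℕ N)) (n%n≡0 (suc N))))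

module Winding (N : ℕ) (Y : Graph) where
  open Cartesian (CycAdj N) (Adj Y)

  wind : ∀ {x y} → Chain (Adj Y) N x y → Walk (ProdAdj N Y) (zero , x) (zero , y)
  wind c = ladder id cycAdj-inject₁-suc c ▷ inj₁ (cycAdj-fromℕ-zero N , refl)

  ∈-wind⁻ : ∀ {x y w} (c : Chain (Adj Y) N x y) → w ∈W wind c →
            w ≡ (zero , x) ⊎ w ≡ (zero , y) ⊎
            Σ (Fin N) λ i → Σ (Vtx Y) λ v → v ∈W pieceWalk c i × w ≡ (suc i , v)
  ∈-wind⁻ c w∈ with ∈-▷⁻ (ladder id cycAdj-inject₁-suc c) _ w∈
  ... | inj₂ refl = inj₂ (inj₁ refl)
  ... | inj₁ w∈ladder with ∈-ladder⁻ id cycAdj-inject₁-suc c w∈ladder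
  ...   | inj₁ w≡start = inj₁ w≡start
  ...   | inj₂ w∈piece = inj₂ (inj₂ w∈piece)

disjoint-∈E : ∀ {G : Graph} {e t : Edge G} {u : Vtx G} → Disjoint e t → u ∈E e → ¬ u ∈E t
disjoint-∈E (src∉t , _) (inj₁ refl) = src∉t
disjoint-∈E (_ , tgt∉t) (inj₂ refl) = tgt∉t

module _ {N : ℕ} {Γ Y : Graph} (P : PiecewiseEmbedding N Γ Y) where
  open PiecewiseEmbedding P
  open Winding N Y

  chain : (e : Edge Γ) → Chain (Adj Y) N (proj₁ (γ e)) (proj₁ (proj₂ (γ e)))
  chain e = proj₁ (proj₂ (proj₂ (γ e)))

  EndpointImage : Edge Γ → Vtx Y → Set
  EndpointImage e y = Σ (Vtx Γ) λ u → u ∈E e × y ≡ f u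

  chain-ends-image : (e : Edge Γ) → EndpointImage e (proj₁ (γ e)) × EndpointImage e (proj₁ (proj₂ (γ e)))
  chain-ends-image e with proj₂ (proj₂ (proj₂ (γ e)))
  ... | inj₁ (a≡ , b≡) = (src e , inj₁ refl , a≡) , (tgt e , inj₂ refl , b≡)
  ... | inj₂ (a≡ , b≡) = (tgt e , inj₂ refl , a≡) , (src e , inj₁ refl , b≡)

  ∈-wind-chain⁻ : ∀ {w} (e : Edge Γ) → w ∈W wind (chain e) →
                  (Σ (Vtx Γ) λ u → u ∈E e × w ≡ (zero , f u)) ⊎
                  (Σ (Fin N) λ i → Σ (Vtx Y) λ v → v ∈W pieceWalk (chain e) i × w ≡ (suc i , v))
  ∈-wind-chain⁻ e w∈ with ∈-wind⁻ (chain e) w∈ | chain-ends-image e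
  ... | inj₁ refl           | (u , u∈e , a≡fu) , _ = inj₁ (u , u∈e , cong (zero ,_) a≡fu)
  ... | inj₂ (inj₁ refl)    | _ , (u , u∈e , b≡fu) = inj₁ (u , u∈e , cong (zero ,_) b≡fu)
  ... | inj₂ (inj₂ w∈piece) | _                    = inj₂ w∈piece

  combEmbedding : CombEmbedding Γ (Fin (suc N) × Vtx Y) (ProdAdj N Y)
  combEmbedding = record
    { fv    = λ v → zero , f v
    ; fe    = λ e → _ , _ , wind (chain e) , Sum.map atZero atZero (proj₂ (proj₂ (proj₂ (γ e))))
    ; inj   = f-inj ∘ cong proj₂
    ; disj  = walks-disjoint
    ; avoid = walk-avoids
    }
    where
    atZero : ∀ {a b c d : Vtx Y} → a ≡ c × b ≡ d → (zero , a) ≡ (zero , c) × (zero , b) ≡ (zero , d)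
    atZero = Product.map (cong (zero ,_)) (cong (zero ,_))

    walks-disjoint : (e t : Edge Γ) → ¬ e ≡ t → Disjoint e t →
                     VDisjoint (wind (chain e)) (wind (chain t))
    walks-disjoint e t _ e∥t _ w∈e w∈t with ∈-wind-chain⁻ e w∈e | ∈-wind-chain⁻ t w∈t
    ... | inj₁ (u , u∈e , refl) | inj₁ (u' , u'∈t , fu≡fu') with f-inj (cong proj₂ fu≡fu')
    ...   | refl = disjoint-∈E {e = e} {t} e∥t u∈e u'∈t
    walks-disjoint e t _ e∥t _ w∈e w∈t | inj₁ (_ , _ , refl) | inj₂ (_ , _ , _ , ())
    walks-disjoint e t _ e∥t _ w∈e w∈t | inj₂ (_ , _ , _ , refl) | inj₁ (_ , _ , ())
    walks-disjoint e t _ e∥t _ w∈e w∈t | inj₂ (i , v , v∈γe , refl) | inj₂ (_ , _ , v∈γt , refl) =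
      disj e t e∥t i v v∈γe v∈γt

    walk-avoids : (e : Edge Γ) (v : Vtx Γ) → ¬ v ∈E e → ¬ (zero , f v) ∈W wind (chain e)
    walk-avoids e v v∉e fv∈ with ∈-wind-chain⁻ e fv∈
    ... | inj₁ (u , u∈e , fv≡fu) with f-inj (cong proj₂ fv≡fu)
    ...   | refl = v∉e u∈e
    walk-avoids e v v∉e fv∈ | inj₂ (_ , _ , _ , ())

mainTheorem11 : (Γ Y : Graph) (N : ℕ) (P : PiecewiseEmbedding N Γ Y) →
    Σ (CombEmbedding Γ (Fin (suc N) × Vtx Y) (ProdAdj N Y)) λ F →
    (v : Vtx Γ) → CombEmbedding.fv F v ≡ (zero , PiecewiseEmbedding.f P v)
mainTheorem11 Γ Y N P = combEmbedding P , λ v → refl
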